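{- Any permutation $\pi$ that avoids $321$ (i.e. $321\not\le\pi$) and is different from $1$ and $12$ satisfies $\mu(1,\pi)=-\mu(21,\pi)$.
   Context: A permutation of size $n$ is a bijection of $[n]$, written as a sequence of values. For $\sigma\in\mathcal{S}_k$, $\pi\in\mathcal{S}_n$, an embedding of $\sigma$ into $\pi$ is a strictly increasing map $f\colon[k]\to[n]$ such that $\pi(f(1)),\dots,\pi(f(k))$ is order-isomorphic to $\sigma(1),\dots,\sigma(k)$; $\sigma\le\pi$ means such an embedding exists. $\mu$ is the Möbius function of this containment poset of all finite permutations: $\mu(x,y)=0$ if $x\not\le y$, $\mu(x,x)=1$, and $\mu(x,y)=-\sum_{x\le z<y}\mu(x,z)$ for $x<y$. -}

module Defs where

-- Convention: a permutation of size n is written as the list of its values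
-- pi(1),...,pi(n), shifted to 0-based values, i.e. a list of naturals whose
-- entries are exactly 0,...,n-1 (each once).  So the paper's 1 is [ 0 ],
-- 12 is [ 0 , 1 ], 21 is [ 1 , 0 ], 321 is [ 2 , 1 , 0 ].

open import Data.Bool using (Bool; true; false; _∧_; _∨_; not; if_then_else_; T)
open import Data.Nat using (ℕ; zero; suc; _<ᵇ_; _≡ᵇ_)
open import Data.List using (List; []; _∷_; length; map; filter; concatMap; upTo; foldr; zipWith)
open import Data.Integer using (ℤ; +_; -_; _+_)

allᵇ : {A : Set} → (A → Bool) → List A → Bool
allᵇ p []       = true
allᵇ p (a ∷ as) = p a ∧ allᵇ p as

anyᵇ : {A : Set} → (A → Bool) → List A → Bool
anyᵇ p []       = false
anyᵇ p (a ∷ as) = p a ∨ anyᵇ p as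

elemᵇ : ℕ → List ℕ → Bool
elemᵇ a []       = false
elemᵇ a (b ∷ bs) = (a ≡ᵇ b) ∨ elemᵇ a bs

distinctᵇ : List ℕ → Bool
distinctᵇ []       = true
distinctᵇ (a ∷ as) = not (elemᵇ a as) ∧ distinctᵇ as

isPermᵇ : List ℕ → Bool
isPermᵇ w = allᵇ (λ a → a <ᵇ length w) w ∧ distinctᵇ w

IsPerm : List ℕ → Set
IsPerm w = T (isPermᵇ w)

lists : ℕ → ℕ → List (List ℕ)
lists m zero    = [] ∷ []
lists m (suc k) = concatMap (λ a → map (a ∷_) (lists m k)) (upTo m)

perms : ℕ → List (List ℕ)
perms k = filter (λ w → T? (isPermᵇ w)) (lists k k)
  where
  open import Relation.Nullary.Decidable using (Dec)
  open import Data.Bool.Properties using (T?)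

-- all subsequences (= images of all strictly increasing maps [k] → [n])
subseqs : List ℕ → List (List ℕ)
subseqs []       = [] ∷ []
subseqs (a ∷ as) = map (a ∷_) (subseqs as) Data.List.++ subseqs as
  where open import Data.List using (_++_)

_⇔ᵇ_ : Bool → Bool → Bool
true  ⇔ᵇ b = b
false ⇔ᵇ b = not b

orderIsoᵇ : List ℕ → List ℕ → Bool
orderIsoᵇ []       []       = true
orderIsoᵇ []       (_ ∷ _)  = false
orderIsoᵇ (_ ∷ _)  []       = false
orderIsoᵇ (a ∷ as) (b ∷ bs) =
  allᵇ (λ t → t) (zipWith (λ c d → (a <ᵇ c) ⇔ᵇ (b <ᵇ d)) as bs)
  ∧ orderIsoᵇ as bs

containsᵇ : List ℕ → List ℕ → Bool
containsᵇ σ π = anyᵇ (orderIsoᵇ σ) (subseqs π)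

_≼_ : List ℕ → List ℕ → Set
σ ≼ π = T (containsᵇ σ π)

eqListᵇ : List ℕ → List ℕ → Bool
eqListᵇ []       []       = true
eqListᵇ []       (_ ∷ _)  = false
eqListᵇ (_ ∷ _)  []       = false
eqListᵇ (a ∷ as) (b ∷ bs) = (a ≡ᵇ b) ∧ eqListᵇ as bs

sumℤ : List ℤ → ℤ
sumℤ = foldr _+_ (+ 0)

permsBelow : ℕ → List (List ℕ)
permsBelow n = concatMap perms (upTo n)

-- Every z with x ≤ z < y has size < |y| (z ≤ y, z ≠ y forces |z| < |y|),
-- and conversely every permutation z of size < |y| with z ≤ y is ≠ y.
μ-aux : ℕ → List ℕ → List ℕ → ℤ
μ-aux zero    x y = if eqListᵇ x y then + 1 else + 0
μ-aux (suc n) x y =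
  if eqListᵇ x y then + 1
  else if containsᵇ x y
    then - sumℤ (map (μ-aux n x)
                     (filter (λ z → T? (containsᵇ x z ∧ containsᵇ z y))
                             (permsBelow (length y))))
    else + 0
  where open import Data.Bool.Properties using (T?)

μ : List ℕ → List ℕ → ℤ
μ x y = μ-aux (length y) x y

-- For 321-avoiding π one shows μ(1,π) + μ(21,π) = δ(π) by induction on π, where δ is 1 at 1,
-- −1 at 12 and 0 elsewhere; the patterns below a 321-avoider avoid 321, so the induction stays
-- inside the class. Since μ(x,σ) = 0 unless x ≤ σ, the defining recursions of μ(1,π) and
-- μ(21,π) can both be summed over all σ < π, and adding them gives
-- μ(1,π) + μ(21,π) = −Σ_{σ<π} δ(σ) = −(δ(1) + δ(12)) = 0 as soon as |π| ≥ 3: a 321-avoider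
-- of length at least 3 contains 12. As δ(π) = 0 for π ∉ {1, 12}, the theorem follows.
module Submission where

open import Defs
open import Data.List using (List; []; _∷_)
open import Data.Nat using (ℕ)
open import Data.Integer using (ℤ; -_)
open import Relation.Binary.PropositionalEquality using (_≡_; _≢_)
open import Relation.Nullary using (¬_)

open import Data.Bool using (Bool; true; false; _∧_; not; if_then_else_; T)
open import Data.Bool.Properties using (T?; T-≡; T-not-≡; T-∧; T-∨; if-eta)
open import Data.Empty using (⊥-elim)
open import Data.Integer using (+_; _+_)
open import Data.Integer.Properties using (+-identityˡ; +-0-abelianGroup; +-commutativeSemigroup)
open import Algebra.Properties.AbelianGroup +-0-abelianGroup using (⁻¹-∙-comm; inverseˡ-unique)
open import Algebra.Properties.CommutativeSemigroup +-commutativeSemigroup using (interchange)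
open import Data.List using (map; filter; zipWith; length; concatMap; applyUpTo)
open import Data.List.Membership.Propositional using (_∈_)
open import Data.List.Membership.Propositional.Properties using (∈-map⁺; ∈-map⁻; ∈-++⁺ˡ; ∈-++⁺ʳ; ∈-++⁻)
open import Data.List.Properties using (map-cong; map-cong-local)
open import Data.List.Relation.Binary.Sublist.Propositional using (_⊆_; []; _∷_; _∷ʳ_; ⊆-refl; ⊆-trans; minimum)
open import Data.List.Relation.Unary.All as All using (All; []; _∷_)
open import Data.List.Relation.Unary.All.Properties using (map⁺; concat⁺; applyUpTo⁺₁; applyUpTo⁺₂; all-filter; filter⁺)
open import Data.List.Relation.Unary.Any using (here; there)
import Data.Nat as ℕ
open import Data.Nat using (zero; suc; _<ᵇ_; _<_; _≤_; s≤s; z≤n)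
open import Data.Nat.Properties using (≡ᵇ⇒≡; ≤-refl; ≤-trans; ≤-pred)
open import Data.Product using (∃-syntax; _×_; _,_; proj₁; proj₂)
open import Data.Sum using (inj₁; inj₂)
open import Function using (Equivalence)
open import Relation.Binary.PropositionalEquality using (refl; cong; cong₂; trans; sym; subst; module ≡-Reasoning)

open Equivalence using (to; from)

anyᵇ⁺ : ∀ {A : Set} (p : A → Bool) {x xs} → x ∈ xs → T (p x) → T (anyᵇ p xs)
anyᵇ⁺ p (here refl)  px = from T-∨ (inj₁ px)
anyᵇ⁺ p (there x∈xs) px = from T-∨ (inj₂ (anyᵇ⁺ p x∈xs px))

anyᵇ⁻ : ∀ {A : Set} (p : A → Bool) xs → T (anyᵇ p xs) → ∃[ x ] x ∈ xs × T (p x)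
anyᵇ⁻ p (x ∷ xs) any-p with to T-∨ any-p
... | inj₁ px   = x , here refl , px
... | inj₂ any′ with anyᵇ⁻ p xs any′
...   | y , y∈xs , py = y , there y∈xs , py

∈-subseqs⁺ : ∀ {s l} → s ⊆ l → s ∈ subseqs l
∈-subseqs⁺ []           = here refl
∈-subseqs⁺ (_ ∷ʳ s⊆l)   = ∈-++⁺ʳ _ (∈-subseqs⁺ s⊆l)
∈-subseqs⁺ (refl ∷ s⊆l) = ∈-++⁺ˡ (∈-map⁺ _ (∈-subseqs⁺ s⊆l))

∈-subseqs⁻ : ∀ {s} l → s ∈ subseqs l → s ⊆ l
∈-subseqs⁻ []      (here refl) = []
∈-subseqs⁻ (a ∷ l) s∈ with ∈-++⁻ (map (a ∷_) (subseqs l)) s∈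
... | inj₂ s∈′ = a ∷ʳ ∈-subseqs⁻ l s∈′
... | inj₁ s∈′ with ∈-map⁻ (a ∷_) s∈′
...   | t , t∈ , refl = refl ∷ ∈-subseqs⁻ l t∈

≼⇒sublist : ∀ σ π → σ ≼ π → ∃[ s ] s ⊆ π × T (orderIsoᵇ σ s)
≼⇒sublist σ π σ≼π with anyᵇ⁻ (orderIsoᵇ σ) (subseqs π) σ≼π
... | s , s∈ , iso = s , ∈-subseqs⁻ π s∈ , iso

sublist⇒≼ : ∀ σ π {s} → s ⊆ π → T (orderIsoᵇ σ s) → σ ≼ π
sublist⇒≼ σ π s⊆π iso = anyᵇ⁺ (orderIsoᵇ σ) (∈-subseqs⁺ s⊆π) iso

restrict : ∀ {s w : List ℕ} → s ⊆ w → List ℕ → List ℕ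
restrict []         _       = []
restrict (_ ∷ʳ _)   []      = []
restrict (_ ∷ʳ s⊆w) (_ ∷ z) = restrict s⊆w z
restrict (_ ∷ _)    []      = []
restrict (_ ∷ s⊆w)  (b ∷ z) = b ∷ restrict s⊆w z

restrict-⊆ : ∀ {s w z} (s⊆w : s ⊆ w) → T (orderIsoᵇ w z) → restrict s⊆w z ⊆ z
restrict-⊆ {z = []}    []         _   = []
restrict-⊆ {z = b ∷ z} (_ ∷ʳ s⊆w) iso = b ∷ʳ restrict-⊆ s⊆w (proj₂ (to T-∧ iso))
restrict-⊆ {z = b ∷ z} (_ ∷ s⊆w)  iso = refl ∷ restrict-⊆ s⊆w (proj₂ (to T-∧ iso))

AllPairs : (ℕ → ℕ → Bool) → List ℕ → List ℕ → Set
AllPairs Q xs ys = T (allᵇ (λ t → t) (zipWith Q xs ys))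

restrict-AllPairs : ∀ Q {s w} (s⊆w : s ⊆ w) z → AllPairs Q w z → AllPairs Q s (restrict s⊆w z)
restrict-AllPairs Q              []           _       _  = _
restrict-AllPairs Q {s = []}     (_ ∷ʳ _)     []      _  = _
restrict-AllPairs Q {s = _ ∷ _}  (_ ∷ʳ _)     []      _  = _
restrict-AllPairs Q              (_ ∷ʳ s⊆w)   (b ∷ z) qs = restrict-AllPairs Q s⊆w z (proj₂ (to T-∧ qs))
restrict-AllPairs Q              (_ ∷ _)      []      _  = _
restrict-AllPairs Q              (refl ∷ s⊆w) (b ∷ z) qs =
  from T-∧ (proj₁ (to T-∧ qs) , restrict-AllPairs Q s⊆w z (proj₂ (to T-∧ qs)))

restrict-orderIso : ∀ {s w} (s⊆w : s ⊆ w) z → T (orderIsoᵇ w z) → T (orderIsoᵇ s (restrict s⊆w z))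
restrict-orderIso          []           []      _   = _
restrict-orderIso          (_ ∷ʳ s⊆w)   (b ∷ z) iso = restrict-orderIso s⊆w z (proj₂ (to T-∧ iso))
restrict-orderIso {a ∷ _}  (refl ∷ s⊆w) (b ∷ z) iso =
  from T-∧ ( restrict-AllPairs (λ c d → (a <ᵇ c) ⇔ᵇ (b <ᵇ d)) s⊆w z (proj₁ (to T-∧ iso))
           , restrict-orderIso s⊆w z (proj₂ (to T-∧ iso)) )

⇔ᵇ-refl : ∀ p → T (p ⇔ᵇ p)
⇔ᵇ-refl true  = _
⇔ᵇ-refl false = _

⇔ᵇ-trans : ∀ p q r → T (p ⇔ᵇ q) → T (q ⇔ᵇ r) → T (p ⇔ᵇ r)
⇔ᵇ-trans true  true  true  _ _ = _
⇔ᵇ-trans false false false _ _ = _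

AllPairs-refl : ∀ a xs → AllPairs (λ c d → (a <ᵇ c) ⇔ᵇ (a <ᵇ d)) xs xs
AllPairs-refl a []       = _
AllPairs-refl a (x ∷ xs) = from T-∧ (⇔ᵇ-refl (a <ᵇ x) , AllPairs-refl a xs)

orderIso-refl : ∀ xs → T (orderIsoᵇ xs xs)
orderIso-refl []       = _
orderIso-refl (a ∷ xs) = from T-∧ (AllPairs-refl a xs , orderIso-refl xs)

AllPairs-trans : ∀ a b c xs ys zs → T (orderIsoᵇ xs ys)
  → AllPairs (λ x y → (a <ᵇ x) ⇔ᵇ (b <ᵇ y)) xs ys
  → AllPairs (λ y z → (b <ᵇ y) ⇔ᵇ (c <ᵇ z)) ys zs
  → AllPairs (λ x z → (a <ᵇ x) ⇔ᵇ (c <ᵇ z)) xs zs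
AllPairs-trans a b c []       _        _        _   _   _   = _
AllPairs-trans a b c (x ∷ xs) []       _        ()
AllPairs-trans a b c (x ∷ xs) (y ∷ ys) []       _   _   _   = _
AllPairs-trans a b c (x ∷ xs) (y ∷ ys) (z ∷ zs) iso ab bc =
  from T-∧ ( ⇔ᵇ-trans (a <ᵇ x) (b <ᵇ y) (c <ᵇ z) (proj₁ (to T-∧ ab)) (proj₁ (to T-∧ bc))
           , AllPairs-trans a b c xs ys zs (proj₂ (to T-∧ iso)) (proj₂ (to T-∧ ab)) (proj₂ (to T-∧ bc)) )

orderIso-trans : ∀ xs ys zs → T (orderIsoᵇ xs ys) → T (orderIsoᵇ ys zs) → T (orderIsoᵇ xs zs)
orderIso-trans []       []       []       _  _  = _
orderIso-trans (a ∷ xs) (b ∷ ys) (c ∷ zs) xy yz =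
  from T-∧ ( AllPairs-trans a b c xs ys zs (proj₂ (to T-∧ xy)) (proj₁ (to T-∧ xy)) (proj₁ (to T-∧ yz))
           , orderIso-trans xs ys zs (proj₂ (to T-∧ xy)) (proj₂ (to T-∧ yz)) )

≼-refl : ∀ σ → σ ≼ σ
≼-refl σ = sublist⇒≼ σ σ ⊆-refl (orderIso-refl σ)

≼-trans : ∀ σ τ π → σ ≼ τ → τ ≼ π → σ ≼ π
≼-trans σ τ π σ≼τ τ≼π with ≼⇒sublist σ τ σ≼τ | ≼⇒sublist τ π τ≼π
... | s , s⊆τ , σ≅s | t , t⊆π , τ≅t =
  sublist⇒≼ σ π (⊆-trans (restrict-⊆ s⊆τ τ≅t) t⊆π)
            (orderIso-trans σ s (restrict s⊆τ t) σ≅s (restrict-orderIso s⊆τ t τ≅t))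

sumℤ-filter : ∀ {A : Set} (b : A → Bool) (f : A → ℤ) xs →
  sumℤ (map f (filter (λ x → T? (b x)) xs)) ≡ sumℤ (map (λ x → if b x then f x else + 0) xs)
sumℤ-filter b f []       = refl
sumℤ-filter b f (x ∷ xs) with b x
... | true  = cong (λ s → f x + s) (sumℤ-filter b f xs)
... | false = trans (sumℤ-filter b f xs) (sym (+-identityˡ _))

sumℤ-+ : ∀ {A : Set} (f g : A → ℤ) xs →
  sumℤ (map (λ x → f x + g x) xs) ≡ sumℤ (map f xs) + sumℤ (map g xs)
sumℤ-+ f g []       = refl
sumℤ-+ f g (x ∷ xs) = trans (cong (λ s → f x + g x + s) (sumℤ-+ f g xs)) (interchange (f x) (g x) _ _)

sumℤ-zero : ∀ {A : Set} {f : A → ℤ} {xs} → All (λ x → f x ≡ + 0) xs → sumℤ (map f xs) ≡ + 0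
sumℤ-zero []            = refl
sumℤ-zero (fx≡0 ∷ zeros) = cong₂ _+_ fx≡0 (sumℤ-zero zeros)

lists-length : ∀ m k → All (λ w → length w ≡ k) (lists m k)
lists-length m zero    = refl ∷ []
lists-length m (suc k) =
  concat⁺ (map⁺ (applyUpTo⁺₂ _ m (λ _ → map⁺ (All.map (cong suc) (lists-length m k)))))

perms-sized : ∀ k → All (λ w → IsPerm w × length w ≡ k) (perms k)
perms-sized k = All.zip (all-filter (λ w → T? (isPermᵇ w)) (lists k k) , filter⁺ _ (lists-length k k))

permsBelow-sized : ∀ n → All (λ w → IsPerm w × length w < n) (permsBelow n)
permsBelow-sized n = concat⁺ (map⁺ (applyUpTo⁺₁ _ n (λ {i} i<n →
  All.map (λ { (perm , refl) → perm , i<n }) (perms-sized i))))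

eqListᵇ⇒≡ : ∀ x y → T (eqListᵇ x y) → x ≡ y
eqListᵇ⇒≡ []      []      _  = refl
eqListᵇ⇒≡ (a ∷ x) (b ∷ y) eq =
  cong₂ _∷_ (≡ᵇ⇒≡ a b (proj₁ (to T-∧ eq))) (eqListᵇ⇒≡ x y (proj₂ (to T-∧ eq)))

≡⇒≼ : ∀ {x y} → x ≡ y → x ≼ y
≡⇒≼ {x} refl = ≼-refl x

μ-aux-⋠ : ∀ n x y → ¬ x ≼ y → μ-aux n x y ≡ + 0
μ-aux-⋠ zero x y x⋠y with eqListᵇ x y in x=y
... | true  = ⊥-elim (x⋠y (≡⇒≼ (eqListᵇ⇒≡ x y (from T-≡ x=y))))
... | false = refl
μ-aux-⋠ (suc n) x y x⋠y with eqListᵇ x y in x=y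
... | true  = ⊥-elim (x⋠y (≡⇒≼ (eqListᵇ⇒≡ x y (from T-≡ x=y))))
... | false with containsᵇ x y
...   | true  = ⊥-elim (x⋠y _)
...   | false = refl

μ-aux-suc : ∀ m x y → x ≢ y → μ-aux (suc m) x y
  ≡ - sumℤ (map (λ w → if containsᵇ w y then μ-aux m x w else + 0) (permsBelow (length y)))
μ-aux-suc m x y x≢y with eqListᵇ x y in x=y | containsᵇ x y in x≼y
... | true  | _     = ⊥-elim (x≢y (eqListᵇ⇒≡ x y (from T-≡ x=y)))
... | false | true  = cong -_ (trans (sumℤ-filter _ (μ-aux m x) (permsBelow (length y)))
                                     (cong sumℤ (map-cong drop-x≼w (permsBelow (length y)))))
  where
  drop-x≼w : ∀ w → (if containsᵇ x w ∧ containsᵇ w y then μ-aux m x w else + 0)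
                 ≡ (if containsᵇ w y then μ-aux m x w else + 0)
  drop-x≼w w with containsᵇ x w in x≼w | containsᵇ w y
  ... | true  | _     = refl
  ... | false | true  = sym (μ-aux-⋠ m x w (subst T x≼w))
  ... | false | false = refl
... | false | false = sym (cong -_ (sumℤ-zero (All.universal vanishes (permsBelow (length y)))))
  where
  vanishes : ∀ w → (if containsᵇ w y then μ-aux m x w else + 0) ≡ + 0
  vanishes w with containsᵇ w y in w≼y
  ... | true  = μ-aux-⋠ m x w (λ x≼w → subst T x≼y (≼-trans x w y x≼w (from T-≡ w≼y)))
  ... | false = refl

if-T : ∀ {A : Set} {b} {x y : A} → T b → (if b then x else y) ≡ x
if-T {b = true} _ = refl

δ : List ℕ → ℤ
δ (0 ∷ [])     = + 1
δ (0 ∷ 1 ∷ []) = - + 1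
δ _            = + 0

δ-vanishes : ∀ w → w ≢ 0 ∷ [] → w ≢ 0 ∷ 1 ∷ [] → δ w ≡ + 0
δ-vanishes []                    _   _   = refl
δ-vanishes (0 ∷ [])              ≢1  _   = ⊥-elim (≢1 refl)
δ-vanishes (0 ∷ 1 ∷ [])          _   ≢12 = ⊥-elim (≢12 refl)
δ-vanishes (0 ∷ 0 ∷ _)           _   _   = refl
δ-vanishes (0 ∷ 1 ∷ _ ∷ _)       _   _   = refl
δ-vanishes (0 ∷ suc (suc _) ∷ _) _   _   = refl
δ-vanishes (suc _ ∷ _)           _   _   = refl

δ-long : ∀ w {k} → length w ≡ 3 ℕ.+ k → δ w ≡ + 0
δ-long w@(_ ∷ _ ∷ _ ∷ _) _ = δ-vanishes w (λ ()) (λ ())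

ascent⇒12 : ∀ a b → T (a <ᵇ b) → T (orderIsoᵇ (0 ∷ 1 ∷ []) (a ∷ b ∷ []))
ascent⇒12 a b a<b = from T-∧ (from T-∧ (a<b , _) , _)

no-ascent⇒321 : ∀ a b d → T (not (a <ᵇ b)) → T (not (b <ᵇ d)) → T (not (a <ᵇ d))
  → T (orderIsoᵇ (2 ∷ 1 ∷ 0 ∷ []) (a ∷ b ∷ d ∷ []))
no-ascent⇒321 a b d a≮b b≮d a≮d =
  from T-∧ (from T-∧ (a≮b , from T-∧ (a≮d , _)) , from T-∧ (from T-∧ (b≮d , _) , _))

avoids-321⇒contains-12 : ∀ a b d r →
  ¬ (2 ∷ 1 ∷ 0 ∷ []) ≼ (a ∷ b ∷ d ∷ r) → (0 ∷ 1 ∷ []) ≼ (a ∷ b ∷ d ∷ r)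
avoids-321⇒contains-12 a b d r avoids with a <ᵇ b in ab | b <ᵇ d in bd | a <ᵇ d in ad
... | true  | _     | _     = sublist⇒≼ (0 ∷ 1 ∷ []) (a ∷ b ∷ d ∷ r)
                                (refl ∷ refl ∷ minimum _) (ascent⇒12 a b (from T-≡ ab))
... | false | true  | _     = sublist⇒≼ (0 ∷ 1 ∷ []) (a ∷ b ∷ d ∷ r)
                                (a ∷ʳ refl ∷ refl ∷ minimum _) (ascent⇒12 b d (from T-≡ bd))
... | false | false | true  = sublist⇒≼ (0 ∷ 1 ∷ []) (a ∷ b ∷ d ∷ r)
                                (refl ∷ b ∷ʳ refl ∷ minimum _) (ascent⇒12 a d (from T-≡ ad))
... | false | false | false = ⊥-elim (avoids (sublist⇒≼ (2 ∷ 1 ∷ 0 ∷ []) (a ∷ b ∷ d ∷ r)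
                                (refl ∷ refl ∷ refl ∷ minimum _)
                                (no-ascent⇒321 a b d (from T-not-≡ ab) (from T-not-≡ bd) (from T-not-≡ ad))))

δ-long-perms : ∀ k → All (λ w → δ w ≡ + 0) (concatMap perms (applyUpTo (3 ℕ.+_) k))
δ-long-perms k = concat⁺ (map⁺ (applyUpTo⁺₂ _ k (λ i →
  All.map (λ { {w} (_ , len) → δ-long w len }) (perms-sized (3 ℕ.+ i)))))

-- permsBelow (length y) unfolds definitionally to ε, 1, 12, 21 followed by the permutations
-- of size at least 3.
δ-sum-below : ∀ y → 3 ≤ length y → (0 ∷ 1 ∷ []) ≼ y →
  sumℤ (map (λ w → if containsᵇ w y then δ w else + 0) (permsBelow (length y))) ≡ + 0
δ-sum-below (_ ∷ _ ∷ []) (s≤s (s≤s ()))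
δ-sum-below y@(_ ∷ _ ∷ _ ∷ r) _ 12≼y =
  cong₂ _+_ (if-eta (containsᵇ [] y))
    (cong₂ _+_ (if-T 1≼y)
      (cong₂ _+_ (if-T 12≼y)
        (cong₂ _+_ (if-eta (containsᵇ (1 ∷ 0 ∷ []) y)) (sumℤ-zero {f = weight} large))))
  where
  weight : List ℕ → ℤ
  weight w = if containsᵇ w y then δ w else + 0
  1≼y : (0 ∷ []) ≼ y
  1≼y = ≼-trans (0 ∷ []) (0 ∷ 1 ∷ []) y _ 12≼y
  large : All (λ w → weight w ≡ + 0) (concatMap perms (applyUpTo (3 ℕ.+_) (length r)))
  large = All.map (λ {w} δw≡0 → trans (cong (if containsᵇ w y then_else + 0) δw≡0) (if-eta _))
                  (δ-long-perms (length r))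

μ-1+μ-21-step : ∀ m y → 3 ≤ length y → (0 ∷ 1 ∷ []) ≼ y →
  (∀ w → IsPerm w × length w < length y → w ≼ y → μ-aux m (0 ∷ []) w + μ-aux m (1 ∷ 0 ∷ []) w ≡ δ w) →
  μ-aux (suc m) (0 ∷ []) y + μ-aux (suc m) (1 ∷ 0 ∷ []) y ≡ + 0
μ-1+μ-21-step m (_ ∷ _ ∷ []) (s≤s (s≤s ()))
μ-1+μ-21-step m y@(_ ∷ _ ∷ _ ∷ _) 3≤∣y∣ 12≼y ih = begin
  μ-aux (suc m) (0 ∷ []) y + μ-aux (suc m) (1 ∷ 0 ∷ []) y
    ≡⟨ cong₂ _+_ (μ-aux-suc m _ y (λ ())) (μ-aux-suc m _ y (λ ())) ⟩
  - sumℤ (map below-1 ws) + - sumℤ (map below-21 ws)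
    ≡⟨ ⁻¹-∙-comm (sumℤ (map below-1 ws)) (sumℤ (map below-21 ws)) ⟩
  - (sumℤ (map below-1 ws) + sumℤ (map below-21 ws))
    ≡⟨ cong -_ (sym (sumℤ-+ below-1 below-21 ws)) ⟩
  - sumℤ (map (λ w → below-1 w + below-21 w) ws)
    ≡⟨ cong (λ ys → - sumℤ ys) (map-cong-local (All.map (λ {w} → by-ih w) (permsBelow-sized (length y)))) ⟩
  - sumℤ (map (λ w → if containsᵇ w y then δ w else + 0) ws)
    ≡⟨ cong -_ (δ-sum-below y 3≤∣y∣ 12≼y) ⟩
  + 0 ∎
  where
  open ≡-Reasoning
  ws : List (List ℕ)
  ws = permsBelow (length y)
  below-1 below-21 : List ℕ → ℤ
  below-1  w = if containsᵇ w y then μ-aux m (0 ∷ []) w else + 0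
  below-21 w = if containsᵇ w y then μ-aux m (1 ∷ 0 ∷ []) w else + 0
  by-ih : ∀ w → IsPerm w × length w < length y →
    below-1 w + below-21 w ≡ (if containsᵇ w y then δ w else + 0)
  by-ih w small with containsᵇ w y in w≼y
  ... | true  = ih w small (from T-≡ w≼y)
  ... | false = refl

μ-1+μ-21 : ∀ n π → IsPerm π → ¬ (2 ∷ 1 ∷ 0 ∷ []) ≼ π → length π ≤ n →
  μ-aux n (0 ∷ []) π + μ-aux n (1 ∷ 0 ∷ []) π ≡ δ π
μ-1+μ-21 zero          []                     _    _      _   = refl
μ-1+μ-21 (suc m)       []                     _    _      _   = refl
μ-1+μ-21 (suc m)       (0 ∷ [])               _    _      _   = refl
μ-1+μ-21 (suc zero)    (_ ∷ _ ∷ _)            _    _      (s≤s ())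
μ-1+μ-21 (suc (suc m)) (0 ∷ 1 ∷ [])           _    _      _   = refl
μ-1+μ-21 (suc (suc m)) (1 ∷ 0 ∷ [])           _    _      _   = refl
μ-1+μ-21 (suc (suc m)) (1 ∷ 1 ∷ [])           ()
μ-1+μ-21 (suc (suc m)) (1 ∷ suc (suc _) ∷ []) ()
μ-1+μ-21 (suc m)       π@(a ∷ b ∷ d ∷ r)      perm avoids ∣π∣≤ =
  trans (μ-1+μ-21-step m π (s≤s (s≤s (s≤s z≤n))) (avoids-321⇒contains-12 a b d r avoids) ih)
        (sym (δ-long π refl))
  where
  ih : ∀ w → IsPerm w × length w < length π → w ≼ π →
    μ-aux m (0 ∷ []) w + μ-aux m (1 ∷ 0 ∷ []) w ≡ δ w
  ih w (perm-w , ∣w∣<∣π∣) w≼π =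
    μ-1+μ-21 m w perm-w (λ 321≼w → avoids (≼-trans (2 ∷ 1 ∷ 0 ∷ []) w π 321≼w w≼π))
             (≤-pred (≤-trans ∣w∣<∣π∣ ∣π∣≤))

corollary7 : (π : List ℕ) → IsPerm π → ¬ ((2 ∷ 1 ∷ 0 ∷ []) ≼ π) → π ≢ (0 ∷ []) → π ≢ (0 ∷ 1 ∷ []) → μ (0 ∷ []) π ≡ - μ (1 ∷ 0 ∷ []) π
corollary7 π perm avoids π≢1 π≢12 =
  inverseˡ-unique (μ (0 ∷ []) π) (μ (1 ∷ 0 ∷ []) π)
    (trans (μ-1+μ-21 (length π) π perm avoids ≤-refl) (δ-vanishes π π≢1 π≢12))
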